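{- Let $n_1,\dots,n_t\ge3$ be integers (not necessarily distinct), $G=K_{n_1}\square\cdots\square K_{n_t}$, $N=\prod_{j=1}^t n_j$, and for each $j$ fix an instruction set generator $(\Delta_{n_j}^i)_{2\le i\le N}$ used for column $j$. Let $O'=(\sigma_i^j)$ be a weak order-generator for $V(G)$ and $O=\Phi_G(O')=(v^1,\dots,v^N)$ (rows). Then $O$ is an ordering of $V(G)$ that induces a consecutive radio labeling of $G$ if and only if $O$ has no repeated rows and, for every $1<i\le N$ and every integer $1\le s<t$ with $i-s\ge1$, at most $s-1$ indices $j\in\{1,\dots,t\}$ satisfy $\sigma_{i-s+1}^j\sigma_{i-s+2}^j\cdots\sigma_i^j\in\Lambda_{s,j}^{i-s+1}(\sigma_1^j,\dots,\sigma_{i-s}^j)$.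
   Context: $S_n$ is the symmetric group on $\{1,\dots,n\}$, with $\sigma\tau=\tau\circ\sigma$. An instruction set is $\{f_2,\dots,f_n\}\subset S_n$ ($n-1$ elements) with $f_k(k)=1$. An instruction set generator is a family of functions $\Delta_n^i:S_n^{i-1}\to\mathcal{P}(S_n)$, $2\le i\le N$, each value an instruction set. $V(K_n)=\{v_1,\dots,v_n\}$. Vertices of $G$ are $t$-tuples $(x_1,\dots,x_t)$ with $x_j\in V(K_{n_j})$; distance is the number of differing coordinates; $\mathrm{diam}(G)=t$. $S_n$ acts on $n$-tuples of distinct elements of $V(K_n)$ by $\sigma\cdot(v_{s_1},\dots,v_{s_n})=(v_{s_{\sigma^{ -1}(1)}},\dots,v_{s_{\sigma^{ -1}(n)}})$. For a column $(\sigma_1,\dots,\sigma_N)$ with $\sigma_1=\mathrm{id}$, $\sigma_2=f_2\in\Delta_n^2(\mathrm{id})$, $\sigma_i\in\Delta_n^i(\sigma_1,\dots,\sigma_{i-1})$, define $o_1=(v_1,\dots,v_n)$, $o_i=\sigma_i\cdot o_{i-1}$, and let $\phi_n(\sigma_1,\dots,\sigma_N)$ be the column of first coordinates of $o_1,\dots,o_N$. A weak order-generator is an $N\times t$ matrix $O'=(\sigma_i^j)$ whose column $j$ is such a column for $n=n_j$ and the generator $\Delta_{n_j}^i$ (first row all $\mathrm{id}$, second row all $f_2$). $\Phi_G(O')$ is the $N\times t$ matrix whose $j$-th column is $\phi_{n_j}$ of the $j$-th column of $O'$; its rows are vertices of $G$. For generator $\Delta_{n_j}^i$, $\Lambda_{s,j}^i(\rho_1,\dots,\rho_{i-1})$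 is the set of products $\tau_1\tau_2\cdots\tau_s$ with $\tau_k\in\Delta_{n_j}^{i+k-1}(\rho_1,\dots,\rho_{i-1},\tau_1,\dots,\tau_{k-1})$ and $\tau_1\cdots\tau_s(1)=1$. An ordering of $V(G)$ is a list of all vertices without repetition; a radio labeling is $f:V(G)\to\mathbb{Z}^+$ with $|f(u)-f(v)|\ge t+1-d(u,v)$ for distinct $u,v$, consecutive if bijective onto $\{1,\dots,N\}$; the labeling induced by an ordering $(v^1,\dots,v^N)$ is $f(v^1)=1$, $f(v^i)=\min\{x\in\mathbb{Z}:x>f(v^{i-1}),\ |x-f(v^l)|\ge t+1-d(v^i,v^l)\ \forall l<i\}$. -}

module Defs where

open import Data.Nat using (ℕ; zero; suc; _+_; _∸_; _≤_; _<_; ∣_-_∣)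
open import Data.Fin using (Fin; zero; suc; toℕ; _≟_)
open import Data.Fin.Permutation using (Permutation′; _⟨$⟩ʳ_; _⟨$⟩ˡ_)
open import Data.Fin.Subset using (Subset; ∣_∣) renaming (_∈_ to _∈ₛ_)
open import Data.List using (List; []; _∷_; _++_; [_]; length; filter; map; allFin)
open import Data.Nat.ListAction using (product)
open import Data.Product using (_×_; _,_; ∃)
open import Relation.Nullary using (¬_; ¬?)
open import Relation.Binary.PropositionalEquality using (_≡_; _≢_)

-- Conventions: {1,…,n} is modelled by Fin n, with the paper's element
-- "1" being the Fin element 'zero' (so paper's k is Fin element with
-- toℕ = k - 1).  Indices i of rows 1..N are 1-based naturals.

oneOf : ∀ {n} → 3 ≤ n → Fin n
oneOf {zero} ()
oneOf {suc n} _ = zero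

module Sym (n : ℕ) (h : 3 ≤ n) where

  𝟏 : Fin n
  𝟏 = oneOf h

  Perm : Set
  Perm = Permutation′ n

  Fun : Set
  Fun = Fin n → Fin n

  _≈_ : Fun → Fun → Set
  f ≈ g = ∀ x → f x ≡ g x

  ap : Perm → Fun
  ap σ x = σ ⟨$⟩ʳ x

  idF : Fun
  idF x = x

  record InstrSet : Set where
    field
      f     : (k : Fin n) → k ≢ 𝟏 → Perm
      f-fix : ∀ k (p : k ≢ 𝟏) → f k p ⟨$⟩ʳ k ≡ 𝟏

  _∈I_ : Perm → InstrSet → Set
  σ ∈I I = ∃ λ k → ∃ λ (p : k ≢ 𝟏) → ap (InstrSet.f I k p) ≈ ap σ

  -- An instruction set generator: Δ^i(ρ_1,…,ρ_{i-1}) is Δ applied to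
  -- the list [ρ_1,…,ρ_{i-1}] (the index i is one plus its length).
  Gen : Set
  Gen = List Perm → InstrSet

  prefix : (ℕ → Perm) → ℕ → List Perm
  prefix σ zero = []
  prefix σ (suc k) = prefix σ k ++ [ σ (suc k) ]

  IsColumn : Gen → ℕ → (ℕ → Perm) → Set
  IsColumn Δ N σ =
    (ap (σ 1) ≈ idF)
    × (2 ≤ N → ∃ λ k → ∃ λ (p : k ≢ 𝟏) →
         (toℕ k ≡ 1) × (ap (σ 2) ≈ ap (InstrSet.f (Δ (prefix σ 1)) k p)))
    × (∀ i → 3 ≤ i → i ≤ N → σ i ∈I Δ (prefix σ (i ∸ 1)))

  -- the n-tuples o_i, encoded as s : {1..n} → {1..n} meaning
  -- (v_{s(1)},…,v_{s(n)});  σ·s = s ∘ σ⁻¹.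
  tuple : (ℕ → Perm) → ℕ → Fun
  tuple σ zero = idF
  tuple σ (suc zero) = idF
  tuple σ (suc (suc i)) x = tuple σ (suc i) (σ (suc (suc i)) ⟨$⟩ˡ x)

  φ : (ℕ → Perm) → ℕ → Fin n
  φ σ i = tuple σ i 𝟏

  -- σ_{a+1} σ_{a+2} ⋯ σ_{a+s}  with  στ = τ ∘ σ
  seqProd : (ℕ → Perm) → ℕ → ℕ → Fun
  seqProd σ a zero = idF
  seqProd σ a (suc s) x = ap (σ (a + suc s)) (seqProd σ a s x)

  Reach : Gen → List Perm → ℕ → Fun → Fun → Set
  Reach Δ hist zero acc g = (acc 𝟏 ≡ 𝟏) × (acc ≈ g)
  Reach Δ hist (suc s) acc g =
    ∃ λ τ → (τ ∈I Δ hist) × Reach Δ (hist ++ [ τ ]) s (λ x → ap τ (acc x)) g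

  -- g ∈ Λ_s^i(ρ_1,…,ρ_{i-1})  where hist = [ρ_1,…,ρ_{i-1}]
  InΛ : Gen → ℕ → List Perm → Fun → Set
  InΛ Δ s hist g = Reach Δ hist s idF g

module Setup (t : ℕ) (n : Fin t → ℕ) (h : ∀ j → 3 ≤ n j) where

  module S (j : Fin t) = Sym (n j) (h j)

  N : ℕ
  N = product (map n (allFin t))

  Vertex : Set
  Vertex = (j : Fin t) → Fin (n j)

  _≈V_ : Vertex → Vertex → Set
  u ≈V v = ∀ j → u j ≡ v j

  dist : Vertex → Vertex → ℕ
  dist u v = length (filter (λ j → ¬? (u j ≟ v j)) (allFin t))

  Generators : Set
  Generators = (j : Fin t) → S.Gen j

  -- an N × t matrix of permutations, entry (i , j) = O' j i (1 ≤ i ≤ N)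
  Matrix : Set
  Matrix = (j : Fin t) → ℕ → S.Perm j

  IsWeakOrderGen : Generators → Matrix → Set
  IsWeakOrderGen Δ O' = ∀ j → S.IsColumn j (Δ j) N (O' j)

  Φ : Matrix → ℕ → Vertex
  Φ O' i j = S.φ j (O' j) i

  NoRepeatedRows : (ℕ → Vertex) → Set
  NoRepeatedRows O = ∀ i l → 1 ≤ i → i ≤ N → 1 ≤ l → l ≤ N → i ≢ l → ¬ (O i ≈V O l)

  IsOrdering : (ℕ → Vertex) → Set
  IsOrdering O = NoRepeatedRows O × (∀ v → ∃ λ i → (1 ≤ i) × (i ≤ N) × (O i ≈V v))

  IsLeast : (ℕ → Set) → ℕ → Set
  IsLeast P x = P x × (∀ y → P y → x ≤ y)

  Admissible : (ℕ → Vertex) → (ℕ → ℕ) → ℕ → ℕ → Set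
  Admissible O lab i x =
    (lab (i ∸ 1) < x)
    × (∀ l → 1 ≤ l → l < i → t + 1 ∸ dist (O i) (O l) ≤ ∣ x - lab l ∣)

  -- lab i = f(v^i) for the labeling f induced by the ordering O
  IsInducedLabeling : (ℕ → Vertex) → (ℕ → ℕ) → Set
  IsInducedLabeling O lab =
    (lab 1 ≡ 1) × (∀ i → 2 ≤ i → i ≤ N → IsLeast (Admissible O lab i) (lab i))

  IsConsecutiveRadio : (ℕ → Vertex) → (ℕ → ℕ) → Set
  IsConsecutiveRadio O lab =
    (∀ i l → 1 ≤ i → i ≤ N → 1 ≤ l → l ≤ N → i ≢ l →
       t + 1 ∸ dist (O i) (O l) ≤ ∣ lab i - lab l ∣)
    × (∀ i → 1 ≤ i → i ≤ N → (1 ≤ lab i) × (lab i ≤ N))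
    × (∀ i l → 1 ≤ i → i ≤ N → 1 ≤ l → l ≤ N → lab i ≡ lab l → i ≡ l)
    × (∀ x → 1 ≤ x → x ≤ N → ∃ λ i → (1 ≤ i) × (i ≤ N) × (lab i ≡ x))

  InducesConsecutiveRadio : (ℕ → Vertex) → Set
  InducesConsecutiveRadio O =
    IsOrdering O × (∀ lab → IsInducedLabeling O lab → IsConsecutiveRadio O lab)

  ΛCond : Generators → Matrix → Fin t → ℕ → ℕ → Set
  ΛCond Δ O' j i s =
    S.InΛ j (Δ j) s (S.prefix j (O' j) (i ∸ s)) (S.seqProd j (O' j) (i ∸ s) s)

  Criterion : Generators → Matrix → Set
  Criterion Δ O' =
    NoRepeatedRows (Φ O')
    × (∀ i → 2 ≤ i → i ≤ N → ∀ s → 1 ≤ s → s < t → s < i →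
         ∀ (J : Subset t) → (∀ j → j ∈ₛ J → ΛCond Δ O' j i s) → ∣ J ∣ ≤ s ∸ 1)

module Submission where

-- The labeling induced by an ordering is greedy and strictly increasing, so it is consecutive
-- exactly when it is the identity i ↦ i, and the identity is a radio labeling exactly when any two
-- rows i > l agree in fewer than i − l coordinates (t + 1 − d = 1 + number of agreements).  For
-- i − l ≥ t this only says that the rows differ.  For s = i − l < t, agreement in column j is the
-- Λ-condition: o_{a+s} is o_a permuted by σ_{a+1}⋯σ_{a+s}, so the first coordinates coincide iff
-- this product fixes 1, and then the column entries themselves witness membership in Λ_{s,j}.
-- Finally, N distinct rows exhaust V(G) because |V(G)| = N.

open import Defs
open import Data.Fin as Fin using (Fin; zero; suc; toℕ; combine; punchOut)
open import Data.Fin.Permutation using (_⟨$⟩ʳ_; _⟨$⟩ˡ_; inverseˡ; inverseʳ)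
open import Data.Fin.Properties
  using (any?; ¬∀⟶∃¬; combine-injective; injective⇒≤; punchOut-injective)
  using (toℕ-injective; toℕ<n)
open import Data.Fin.Subset using (Subset; inside; outside; ⁅_⁆; ∣_∣)
  renaming (_∈_ to _∈ₛ_)
open import Data.Fin.Subset.Properties using (x∈⁅y⁆⇒x≡y; ∣⁅x⁆∣≡1)
open import Data.List using ([]; _∷_; length; filter; tabulate; allFin)
open import Data.List.Properties using (length-tabulate; filter-≐; map-tabulate)
open import Data.Nat
open import Data.Nat.Induction using (<-rec)
open import Data.Nat.ListAction using (product)
open import Data.Nat.Properties
open import Data.Product using (_×_; _,_; ∃; proj₁; proj₂)
open import Data.Sum using (inj₁; inj₂)
open import Data.Vec using ([]; _∷_; here; there)
open import Function using (id; _∘_)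
open import Function.Bundles using (_⇔_; mk⇔; Equivalence)
open import Function.Construct.Composition using (_⇔-∘_)
open import Function.Construct.Symmetry using (⇔-sym)
open import Function.Definitions using (Injective)
open import Relation.Nullary using (¬_; ¬?; yes; no; contradiction)
open import Relation.Nullary.Decidable using (_×-dec_; _→-dec_; map′)
open import Relation.Unary using (Pred; Decidable)
open import Relation.Binary.Definitions using (tri<; tri≈; tri>)
open import Relation.Binary.PropositionalEquality

Least : (ℕ → Set) → ℕ → Set
Least P x = P x × (∀ y → P y → x ≤ y)

∃-least : {P : ℕ → Set} → Decidable P → ∀ {b} → P b → ∃ (Least P)
∃-least {P} P? {b} = <-rec (λ b → P b → ∃ (Least P)) search b
  where
  search : ∀ b → (∀ {c} → c < b → P c → ∃ (Least P)) → P b → ∃ (Least P)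
  search b below Pb with anyUpTo? P? b
  ... | yes (c , c<b , Pc) = below c<b Pc
  ... | no none = b , Pb , λ y Py → ≮⇒≥ (λ y<b → none (y , y<b , Py))

<⇒≤∸1 : ∀ {m n} → m < n → m ≤ n ∸ 1
<⇒≤∸1 {m} {n} m<n = subst (m ≤_) (pred[m∸n]≡m∸[1+n] n 0) (<⇒≤pred m<n)

≤∸1⇒< : ∀ {m n} → 1 ≤ n → m ≤ n ∸ 1 → m < n
≤∸1⇒< {n = n} 1≤n m≤n∸1 = ≤-<-trans m≤n∸1 (∸-monoʳ-< {n} {1} {0} ≤-refl 1≤n)

maxUpTo : (ℕ → ℕ) → ℕ → ℕ
maxUpTo f zero = f zero
maxUpTo f (suc i) = f (suc i) ⊔ maxUpTo f i

≤-maxUpTo : ∀ f {m i} → m ≤ i → f m ≤ maxUpTo f i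
≤-maxUpTo f {i = zero} z≤n = ≤-refl
≤-maxUpTo f {m} {suc i} m≤1+i with m≤n⇒m<n∨m≡n m≤1+i
... | inj₁ m<1+i = m≤n⇒m≤o⊔n (f (suc i)) (≤-maxUpTo f (≤-pred m<1+i))
... | inj₂ refl = m≤m⊔n (f (suc i)) (maxUpTo f i)

patch : (ℕ → ℕ) → ℕ → ℕ → ℕ → ℕ
patch f i x m with m ≤? i
... | yes _ = f m
... | no _ = x

patch-≤ : ∀ f {i} x {m} → m ≤ i → patch f i x m ≡ f m
patch-≤ f {i} x {m} m≤i with m ≤? i
... | yes _ = refl
... | no m≰i = contradiction m≤i m≰i

patch-suc : ∀ f i x → patch f i x (suc i) ≡ x
patch-suc f i x with suc i ≤? i
... | yes 1+i≤i = contradiction 1+i≤i 1+n≰n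
... | no _ = refl

-- A f i x: the value x is acceptable at position i, given the values of f below i.
module Greedy {A : (ℕ → ℕ) → ℕ → ℕ → Set}
  (A? : ∀ f i → Decidable (A f i))
  (A-local : ∀ {f g i x} → (∀ {m} → m ≤ i → f m ≡ g m) → A f (suc i) x → A g (suc i) x)
  (A-satisfiable : ∀ f i → ∃ (A f i)) where

  GreedyUpTo : ℕ → (ℕ → ℕ) → Set
  GreedyUpTo k f = f 1 ≡ 1 × (∀ i → 2 ≤ i → i ≤ k → Least (A f i) (f i))

  Least-local : ∀ {f g i x} → (∀ {m} → m ≤ i → f m ≡ g m) →
                Least (A f (suc i)) x → Least (A g (suc i)) x
  Least-local f≡g (Ax , least) =
    A-local f≡g Ax , λ y Ay → least y (A-local (sym ∘ f≡g) Ay)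

  greedy : ∀ k → ∃ (GreedyUpTo (suc k))
  greedy zero = (λ _ → 1) , refl , λ i 2≤i i≤1 → contradiction 2≤i (≤⇒≯ i≤1)
  greedy (suc k) with greedy k
  ... | f , f1≡1 , f-greedy =
    g , trans (patch-≤ f {suc k} x {1} (s≤s z≤n)) f1≡1 , g-greedy
    where
    x : ℕ
    x = proj₁ (∃-least (A? f (suc (suc k))) (proj₂ (A-satisfiable f (suc (suc k)))))

    x-least : Least (A f (suc (suc k))) x
    x-least = proj₂ (∃-least (A? f (suc (suc k))) (proj₂ (A-satisfiable f (suc (suc k)))))

    g : ℕ → ℕ
    g = patch f (suc k) x

    g-greedy : ∀ i → 2 ≤ i → i ≤ suc (suc k) → Least (A g i) (g i)
    g-greedy (suc i) 2≤i i≤2+k with m≤n⇒m<n∨m≡n i≤2+k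
    ... | inj₁ i<2+k rewrite patch-≤ f x (≤-pred i<2+k) =
      Least-local (λ m≤i → sym (patch-≤ f x (≤-trans m≤i (<⇒≤ (≤-pred i<2+k)))))
        (f-greedy (suc i) 2≤i (≤-pred i<2+k))
    ... | inj₂ refl rewrite patch-suc f (suc k) x =
      Least-local (λ m≤1+k → sym (patch-≤ f x m≤1+k)) x-least

module _ {f : ℕ → ℕ} {N : ℕ}
         (f-increasing : ∀ {k} → 1 ≤ k → suc k ≤ N → f k < f (suc k)) where

  increasing⇒+-≤ : ∀ {i} d → 1 ≤ i → i + d ≤ N → f i + d ≤ f (i + d)
  increasing⇒+-≤ {i} zero _ _ rewrite +-identityʳ i | +-identityʳ (f i) = ≤-refl
  increasing⇒+-≤ {i} (suc d) 1≤i i+1+d≤N rewrite +-suc i d | +-suc (f i) d =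
    ≤-<-trans (increasing⇒+-≤ d 1≤i (≤-trans (n≤1+n (i + d)) i+1+d≤N))
              (f-increasing (≤-trans 1≤i (m≤m+n i d)) i+1+d≤N)

  increasing⇒≥id : f 1 ≡ 1 → ∀ {i} → 1 ≤ i → i ≤ N → i ≤ f i
  increasing⇒≥id f1≡1 {i} 1≤i i≤N = begin
    i                 ≡⟨ 1+[i∸1]≡i ⟨
    1 + (i ∸ 1)       ≡⟨ cong (_+ (i ∸ 1)) f1≡1 ⟨
    f 1 + (i ∸ 1)     ≤⟨ increasing⇒+-≤ (i ∸ 1) ≤-refl (subst (_≤ N) (sym 1+[i∸1]≡i) i≤N) ⟩
    f (1 + (i ∸ 1))   ≡⟨ cong f 1+[i∸1]≡i ⟩
    f i               ∎
    where
    open ≤-Reasoning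
    1+[i∸1]≡i = m+[n∸m]≡n 1≤i

  increasing⇒≤id : f N ≤ N → ∀ {i} → 1 ≤ i → i ≤ N → f i ≤ i
  increasing⇒≤id fN≤N {i} 1≤i i≤N = +-cancelʳ-≤ (N ∸ i) (f i) i (begin
    f i + (N ∸ i)     ≤⟨ increasing⇒+-≤ (N ∸ i) 1≤i (≤-reflexive (m+[n∸m]≡n i≤N)) ⟩
    f (i + (N ∸ i))   ≡⟨ cong f (m+[n∸m]≡n i≤N) ⟩
    f N               ≤⟨ fN≤N ⟩
    N                 ≡⟨ m+[n∸m]≡n i≤N ⟨
    i + (N ∸ i)       ∎)
    where open ≤-Reasoning

module _ {a p} {A : Set a} {P : Pred A p} (P? : Decidable P) where

  length-filter+length-filter-∁ : ∀ xs →
    length (filter P? xs) + length (filter (¬? ∘ P?) xs) ≡ length xs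
  length-filter+length-filter-∁ [] = refl
  length-filter+length-filter-∁ (x ∷ xs) with P? x
  ... | yes _ = cong suc (length-filter+length-filter-∁ xs)
  ... | no _ = trans (+-suc _ _) (cong suc (length-filter+length-filter-∁ xs))

  ∣∣≤length-filter : ∀ {t} (J : Subset t) (f : Fin t → A) →
                     (∀ {j} → j ∈ₛ J → P (f j)) → ∣ J ∣ ≤ length (filter P? (tabulate f))
  ∣∣≤length-filter [] f J⊆P = z≤n
  ∣∣≤length-filter (_ ∷ J) f J⊆P
    with P? (f zero) | ∣∣≤length-filter J (f ∘ suc) (J⊆P ∘ there)
  ∣∣≤length-filter (inside ∷ J) f J⊆P | yes _ | ih = s≤s ih
  ∣∣≤length-filter (outside ∷ J) f J⊆P | yes _ | ih = m≤n⇒m≤1+n ih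
  ∣∣≤length-filter (inside ∷ J) f J⊆P | no ¬P | ih = contradiction (J⊆P here) ¬P
  ∣∣≤length-filter (outside ∷ J) f J⊆P | no _ | ih = ih

  length-filter≤∣∣ : ∀ {t} (f : Fin t → A) →
                     ∃ λ J → (∀ {j} → j ∈ₛ J → P (f j)) × length (filter P? (tabulate f)) ≤ ∣ J ∣
  length-filter≤∣∣ {zero} f = [] , (λ ()) , z≤n
  length-filter≤∣∣ {suc t} f with P? (f zero) | length-filter≤∣∣ (f ∘ suc)
  ... | yes P₀ | J , J⊆P , ≤∣J∣ =
    inside ∷ J , (λ { here → P₀ ; (there j∈J) → J⊆P j∈J }) , s≤s ≤∣J∣
  ... | no _   | J , J⊆P , ≤∣J∣ =
    outside ∷ J , (λ { (there j∈J) → J⊆P j∈J }) , ≤∣J∣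

injective⇒surjective : ∀ {m} {f : Fin m → Fin m} → Injective _≡_ _≡_ f →
                       ∀ y → ∃ λ x → f x ≡ y
injective⇒surjective {suc m} {f} f-injective y with any? (λ x → f x Fin.≟ y)
... | yes hit = hit
... | no miss = contradiction (injective⇒≤ g-injective) 1+n≰n
  where
  y≢f : ∀ x → y ≢ f x
  y≢f x y≡fx = miss (x , sym y≡fx)

  g : Fin (suc m) → Fin m
  g x = punchOut (y≢f x)

  g-injective : Injective _≡_ _≡_ g
  g-injective {x} {x′} = f-injective ∘ punchOut-injective (y≢f x) (y≢f x′)

encode : ∀ {t} (n : Fin t → ℕ) → ((j : Fin t) → Fin (n j)) → Fin (product (tabulate n))
encode {zero} n v = zero
encode {suc t} n v = combine (v zero) (encode (n ∘ suc) (v ∘ suc))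

encode-injective : ∀ {t} (n : Fin t → ℕ) {u v : (j : Fin t) → Fin (n j)} →
                   encode n u ≡ encode n v → ∀ j → u j ≡ v j
encode-injective {suc t} n {u} {v} eq j
  with u₀≡v₀ , rest ← combine-injective (u zero) _ (v zero) _ eq
  with j
... | zero = u₀≡v₀
... | suc j = encode-injective (n ∘ suc) rest j

module ColumnProperties (n : ℕ) (h : 3 ≤ n) where
  open Sym n h

  ⟨$⟩ˡ-injective : ∀ (π : Perm) {x y} → π ⟨$⟩ˡ x ≡ π ⟨$⟩ˡ y → x ≡ y
  ⟨$⟩ˡ-injective π {x} {y} eq = begin
    x                  ≡⟨ inverseʳ π ⟨
    π ⟨$⟩ʳ (π ⟨$⟩ˡ x)  ≡⟨ cong (π ⟨$⟩ʳ_) eq ⟩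
    π ⟨$⟩ʳ (π ⟨$⟩ˡ y)  ≡⟨ inverseʳ π ⟩
    y                  ∎
    where open ≡-Reasoning

  tuple-injective : ∀ σ k {x y} → tuple σ k x ≡ tuple σ k y → x ≡ y
  tuple-injective σ zero eq = eq
  tuple-injective σ (suc zero) eq = eq
  tuple-injective σ (suc (suc k)) eq =
    ⟨$⟩ˡ-injective (σ (suc (suc k))) (tuple-injective σ (suc k) eq)

  tuple-seqProd : ∀ σ {a} → 1 ≤ a → ∀ s x → tuple σ (a + s) (seqProd σ a s x) ≡ tuple σ a x
  tuple-seqProd σ {a} _ zero x rewrite +-identityʳ a = refl
  tuple-seqProd σ {suc a} 1≤a (suc s) x rewrite +-suc (suc a) s =
    trans (cong (tuple σ (suc a + s)) (inverseˡ (σ (suc (suc a + s)))))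
          (tuple-seqProd σ 1≤a s x)

  φ-≡⇔seqProd-fixes : ∀ σ {a} → 1 ≤ a → ∀ s → φ σ (a + s) ≡ φ σ a ⇔ seqProd σ a s 𝟏 ≡ 𝟏
  φ-≡⇔seqProd-fixes σ {a} 1≤a s = mk⇔
    (λ φ≡ → tuple-injective σ (a + s) (trans (tuple-seqProd σ 1≤a s 𝟏) (sym φ≡)))
    (λ fixes → trans (cong (tuple σ (a + s)) (sym fixes)) (tuple-seqProd σ 1≤a s 𝟏))

  seqProd-suc : ∀ σ a s x → seqProd σ a (suc s) x ≡ seqProd σ (suc a) s (ap (σ (suc a)) x)
  seqProd-suc σ a zero x = cong (λ k → ap (σ k) x) (+-comm a 1)
  seqProd-suc σ a (suc s) x =
    cong₂ (λ k → ap (σ k)) (+-suc a (suc s)) (seqProd-suc σ a s x)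

  Reach-fixes : ∀ {Δ hist} s {acc g} → Reach Δ hist s acc g → g 𝟏 ≡ 𝟏
  Reach-fixes zero {acc} {g} (acc-fixes , acc≈g) = trans (sym (acc≈g 𝟏)) acc-fixes
  Reach-fixes (suc s) (_ , _ , reach) = Reach-fixes s reach

  Reach-cong : ∀ {Δ hist} s {acc g g′} → g ≈ g′ →
               Reach Δ hist s acc g → Reach Δ hist s acc g′
  Reach-cong zero g≈g′ (acc-fixes , acc≈g) = acc-fixes , λ x → trans (acc≈g x) (g≈g′ x)
  Reach-cong (suc s) g≈g′ (τ , τ∈ , reach) = τ , τ∈ , Reach-cong s g≈g′ reach

  module _ {Δ N σ} (column : IsColumn Δ N σ) where

    column-∈I : ∀ {k} → 2 ≤ k → k ≤ N → σ k ∈I Δ (prefix σ (k ∸ 1))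
    column-∈I {suc zero} (s≤s ()) _
    column-∈I {suc (suc zero)} _ 2≤N with proj₁ (proj₂ column) 2≤N
    ... | k , k≢𝟏 , _ , σ₂≈f = k , k≢𝟏 , sym ∘ σ₂≈f
    column-∈I {suc (suc (suc k))} _ k≤N =
      proj₂ (proj₂ column) _ (s≤s (s≤s (s≤s z≤n))) k≤N

    -- The column itself supplies the witnesses τₖ = σ_{b+k}.
    seqProd-Reach : ∀ {b} r acc → 1 ≤ b → b + r ≤ N → seqProd σ b r (acc 𝟏) ≡ 𝟏 →
                    Reach Δ (prefix σ b) r acc (λ x → seqProd σ b r (acc x))
    seqProd-Reach zero acc _ _ fixes = fixes , λ _ → refl
    seqProd-Reach {b} (suc r) acc 1≤b b+1+r≤N fixes =
      σ (suc b) , column-∈I (s≤s 1≤b) 1+b≤N ,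
      Reach-cong r (λ x → sym (seqProd-suc σ b r (acc x)))
        (seqProd-Reach r (ap (σ (suc b)) ∘ acc) (s≤s z≤n) 1+b+r≤N
          (trans (sym (seqProd-suc σ b r (acc 𝟏))) fixes))
      where
      1+b+r≤N : suc b + r ≤ N
      1+b+r≤N = subst (_≤ N) (+-suc b r) b+1+r≤N

      1+b≤N : suc b ≤ N
      1+b≤N = ≤-trans (m≤m+n (suc b) r) 1+b+r≤N

    InΛ⇔φ-≡ : ∀ {a s} → 1 ≤ a → a + s ≤ N →
              InΛ Δ s (prefix σ a) (seqProd σ a s) ⇔ φ σ (a + s) ≡ φ σ a
    InΛ⇔φ-≡ {a} {s} 1≤a a+s≤N = mk⇔
      (λ inΛ → Equivalence.from (φ-≡⇔seqProd-fixes σ 1≤a s) (Reach-fixes s inΛ))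
      (λ φ≡ → seqProd-Reach s idF 1≤a a+s≤N
                (Equivalence.to (φ-≡⇔seqProd-fixes σ 1≤a s) φ≡))

module Graph (t : ℕ) (n : Fin t → ℕ) (h : ∀ j → 3 ≤ n j) where
  open Setup t n h

  agreements : Vertex → Vertex → ℕ
  agreements u v = length (filter (λ j → u j Fin.≟ v j) (allFin t))

  agreements+dist : ∀ u v → agreements u v + dist u v ≡ t
  agreements+dist u v =
    trans (length-filter+length-filter-∁ (λ j → u j Fin.≟ v j) (allFin t)) (length-tabulate id)

  t+1∸dist≡1+agreements : ∀ u v → t + 1 ∸ dist u v ≡ suc (agreements u v)
  t+1∸dist≡1+agreements u v = begin
    t + 1 ∸ d      ≡⟨ cong (λ k → k + 1 ∸ d) (agreements+dist u v) ⟨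
    a + d + 1 ∸ d  ≡⟨ cong (_∸ d) (+-comm (a + d) 1) ⟩
    suc a + d ∸ d  ≡⟨ m+n∸n≡m (suc a) d ⟩
    suc a          ∎
    where
    open ≡-Reasoning
    a = agreements u v
    d = dist u v

  dist-sym : ∀ u v → dist u v ≡ dist v u
  dist-sym u v = cong length (filter-≐ (λ j → ¬? (u j Fin.≟ v j)) (λ j → ¬? (v j Fin.≟ u j))
                                       ((_∘ sym) , (_∘ sym)) (allFin t))

  ∣∣≤agreements : ∀ {u v} (J : Subset t) → (∀ {j} → j ∈ₛ J → u j ≡ v j) →
                  ∣ J ∣ ≤ agreements u v
  ∣∣≤agreements {u} {v} J J⊆agree = ∣∣≤length-filter (λ j → u j Fin.≟ v j) J id J⊆agree

  agreements<t : ∀ {u v} → ¬ u ≈V v → agreements u v < t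
  agreements<t {u} {v} u≉v with j , uj≢vj ← ¬∀⟶∃¬ t _ (λ j → u j Fin.≟ v j) u≉v =
    begin-strict
    agreements u v             <⟨ m<m+n (agreements u v) 1≤dist ⟩
    agreements u v + dist u v  ≡⟨ agreements+dist u v ⟩
    t                          ∎
    where
    open ≤-Reasoning

    1≤dist : 1 ≤ dist u v
    1≤dist = subst (_≤ dist u v) (∣⁅x⁆∣≡1 j)
      (∣∣≤length-filter (λ j → ¬? (u j Fin.≟ v j)) ⁅ j ⁆ id
        (λ k∈⁅j⁆ → subst (λ k → u k ≢ v k) (sym (x∈⁅y⁆⇒x≡y j k∈⁅j⁆)) uj≢vj))

  -- i ↦ i is a radio labeling of the rows O 1, …, O N (via t + 1 ∸ dist ≡ 1 + agreements).
  IdentityRadio : (ℕ → Vertex) → Set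
  IdentityRadio O = ∀ {i l} → 1 ≤ l → l < i → i ≤ N → agreements (O i) (O l) < i ∸ l

  module _ (O : ℕ → Vertex) where

    admissible? : ∀ lab i → Decidable (Admissible O lab i)
    admissible? lab i x = lab (i ∸ 1) <? x ×-dec
      map′ (λ below l 1≤l l<i → below l<i 1≤l) (λ below {l} l<i 1≤l → below l 1≤l l<i)
        (allUpTo? (λ l → 1 ≤? l →-dec (t + 1 ∸ dist (O i) (O l) ≤? ∣ x - lab l ∣)) i)

    Admissible-local : ∀ {f g i x} → (∀ {m} → m ≤ i → f m ≡ g m) →
                       Admissible O f (suc i) x → Admissible O g (suc i) x
    Admissible-local {f} {g} {i} {x} f≡g (fi<x , far) =
      subst (_< x) (f≡g ≤-refl) fi<x ,
      λ l 1≤l l≤i → subst (λ y → t + 1 ∸ dist (O (suc i)) (O l) ≤ ∣ x - y ∣)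
                          (f≡g (≤-pred l≤i)) (far l 1≤l l≤i)

    -- Any label exceeding all earlier ones by t + 1 is admissible.
    Admissible-satisfiable : ∀ lab i → ∃ (Admissible O lab i)
    Admissible-satisfiable lab i =
      t + 1 + M , ≤-<-trans (≤-maxUpTo lab (m∸n≤m i 1)) (m<n+m M (m≤n+m 1 t)) ,
      λ l _ l<i → begin
        t + 1 ∸ dist (O i) (O l)  ≤⟨ m∸n≤m (t + 1) (dist (O i) (O l)) ⟩
        t + 1                     ≡⟨ m+n∸n≡m (t + 1) M ⟨
        t + 1 + M ∸ M             ≤⟨ ∸-monoʳ-≤ (t + 1 + M) (≤-maxUpTo lab (<⇒≤ l<i)) ⟩
        t + 1 + M ∸ lab l         ≡⟨ m≤n⇒∣n-m∣≡n∸m (≤-trans (≤-maxUpTo lab (<⇒≤ l<i)) M≤x) ⟨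
        ∣ t + 1 + M - lab l ∣     ∎
      where
      open ≤-Reasoning
      M = maxUpTo lab i
      M≤x = m≤n+m M (t + 1)

    inducedLabeling : ∃ (IsInducedLabeling O)
    inducedLabeling
      with lab , lab1≡1 , greedy ← Greedy.greedy admissible? Admissible-local Admissible-satisfiable N
      = lab , lab1≡1 , λ i 2≤i i≤N → greedy i 2≤i (m≤n⇒m≤1+n i≤N)

    identityRadio-< : IdentityRadio O → ∀ {i l} → 1 ≤ l → l < i → i ≤ N →
                      t + 1 ∸ dist (O i) (O l) ≤ ∣ i - l ∣
    identityRadio-< idRadio {i} {l} 1≤l l<i i≤N = begin
      t + 1 ∸ dist (O i) (O l)      ≡⟨ t+1∸dist≡1+agreements (O i) (O l) ⟩
      suc (agreements (O i) (O l))  ≤⟨ idRadio 1≤l l<i i≤N ⟩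
      i ∸ l                         ≡⟨ m≤n⇒∣n-m∣≡n∸m (<⇒≤ l<i) ⟨
      ∣ i - l ∣                     ∎
      where open ≤-Reasoning

    identityRadio-≢ : IdentityRadio O → ∀ {i l} → 1 ≤ i → i ≤ N → 1 ≤ l → l ≤ N →
                      i ≢ l → t + 1 ∸ dist (O i) (O l) ≤ ∣ i - l ∣
    identityRadio-≢ idRadio {i} {l} 1≤i i≤N 1≤l l≤N i≢l with <-cmp i l
    ... | tri< i<l _ _ = begin
      t + 1 ∸ dist (O i) (O l)  ≡⟨ cong (t + 1 ∸_) (dist-sym (O i) (O l)) ⟩
      t + 1 ∸ dist (O l) (O i)  ≤⟨ identityRadio-< idRadio 1≤i i<l l≤N ⟩
      ∣ l - i ∣                 ≡⟨ ∣-∣-comm l i ⟩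
      ∣ i - l ∣                 ∎
      where open ≤-Reasoning
    ... | tri≈ _ i≡l _ = contradiction i≡l i≢l
    ... | tri> _ _ l<i = identityRadio-< idRadio 1≤l l<i i≤N

    ≡id⇒consecutiveRadio : IdentityRadio O → ∀ {lab} → (∀ {i} → 1 ≤ i → i ≤ N → lab i ≡ i) →
                           IsConsecutiveRadio O lab
    ≡id⇒consecutiveRadio idRadio {lab} lab≡id =
      (λ i l 1≤i i≤N 1≤l l≤N i≢l →
         subst₂ (λ x y → t + 1 ∸ dist (O i) (O l) ≤ ∣ x - y ∣)
                (sym (lab≡id 1≤i i≤N)) (sym (lab≡id 1≤l l≤N))
                (identityRadio-≢ idRadio 1≤i i≤N 1≤l l≤N i≢l)) ,
      (λ i 1≤i i≤N → subst (1 ≤_) (sym (lab≡id 1≤i i≤N)) 1≤i ,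
                     subst (_≤ N) (sym (lab≡id 1≤i i≤N)) i≤N) ,
      (λ i l 1≤i i≤N 1≤l l≤N labi≡labl →
         trans (sym (lab≡id 1≤i i≤N)) (trans labi≡labl (lab≡id 1≤l l≤N))) ,
      (λ x 1≤x x≤N → x , 1≤x , x≤N , lab≡id 1≤x x≤N)

    -- Distinct rows are encoded injectively into Fin N, so they exhaust Fin N.
    rows-surjective : NoRepeatedRows O → ∀ v → ∃ λ i → (1 ≤ i) × (i ≤ N) × (O i ≈V v)
    rows-surjective noRep v = suc (toℕ k) , s≤s z≤n , index≤N k , encode-injective n row[k]≡v
      where
      index≤N : (k : Fin (product (tabulate n))) → suc (toℕ k) ≤ N
      index≤N k = subst (suc (toℕ k) ≤_) (sym (cong product (map-tabulate id n))) (toℕ<n k)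

      row : Fin (product (tabulate n)) → Fin (product (tabulate n))
      row k = encode n (O (suc (toℕ k)))

      row-injective : Injective _≡_ _≡_ row
      row-injective {k} {k′} eq with suc (toℕ k) ≟ suc (toℕ k′)
      ... | yes k≡k′ = toℕ-injective (suc-injective k≡k′)
      ... | no k≢k′ = contradiction (encode-injective n eq)
                        (noRep _ _ (s≤s z≤n) (index≤N k) (s≤s z≤n) (index≤N k′) k≢k′)

      k : Fin (product (tabulate n))
      k = proj₁ (injective⇒surjective row-injective (encode n v))

      row[k]≡v : row k ≡ encode n v
      row[k]≡v = proj₂ (injective⇒surjective row-injective (encode n v))

    module _ {lab} (induced : IsInducedLabeling O lab) where

      induced-increasing : ∀ {k} → 1 ≤ k → suc k ≤ N → lab k < lab (suc k)
      induced-increasing 1≤k 1+k≤N = proj₁ (proj₁ (proj₂ induced _ (s≤s 1≤k) 1+k≤N))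

      consecutive⇒identityRadio : IsConsecutiveRadio O lab → IdentityRadio O
      consecutive⇒identityRadio (radio , inRange , _ , _) {i} {l} 1≤l l<i i≤N = begin
        suc (agreements (O i) (O l))  ≡⟨ t+1∸dist≡1+agreements (O i) (O l) ⟨
        t + 1 ∸ dist (O i) (O l)      ≤⟨ radio i l 1≤i i≤N 1≤l l≤N (>⇒≢ l<i) ⟩
        ∣ lab i - lab l ∣             ≡⟨ cong₂ ∣_-_∣ (lab≡id 1≤i i≤N) (lab≡id 1≤l l≤N) ⟩
        ∣ i - l ∣                     ≡⟨ m≤n⇒∣n-m∣≡n∸m (<⇒≤ l<i) ⟩
        i ∸ l                         ∎
        where
        open ≤-Reasoning
        1≤i = ≤-trans 1≤l (<⇒≤ l<i)
        l≤N = ≤-trans (<⇒≤ l<i) i≤N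

        lab≡id : ∀ {k} → 1 ≤ k → k ≤ N → lab k ≡ k
        lab≡id 1≤k k≤N = ≤-antisym
          (increasing⇒≤id induced-increasing labN≤N 1≤k k≤N)
          (increasing⇒≥id induced-increasing (proj₁ induced) 1≤k k≤N)
          where labN≤N = proj₂ (inRange N (≤-trans 1≤i i≤N) ≤-refl)

      -- Once lab agrees with the identity below i, i itself is admissible, so lab i ≤ i.
      identityRadio⇒≡id : IdentityRadio O → ∀ {i} → 1 ≤ i → i ≤ N → lab i ≡ i
      identityRadio⇒≡id idRadio {i} = <-rec (λ i → 1 ≤ i → i ≤ N → lab i ≡ i) step i
        where
        step : ∀ i → (∀ {l} → l < i → 1 ≤ l → l ≤ N → lab l ≡ l) →
               1 ≤ i → i ≤ N → lab i ≡ i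
        step (suc zero) _ _ _ = proj₁ induced
        step i@(suc (suc k)) below _ i≤N = ≤-antisym
          (proj₂ (proj₂ induced i (s≤s (s≤s z≤n)) i≤N) i i-admissible)
          (increasing⇒≥id induced-increasing (proj₁ induced) (s≤s z≤n) i≤N)
          where
          labl≡l : ∀ {l} → 1 ≤ l → l < i → lab l ≡ l
          labl≡l 1≤l l<i = below l<i 1≤l (≤-trans (<⇒≤ l<i) i≤N)

          i-admissible : Admissible O lab i i
          i-admissible = subst (_< i) (sym (labl≡l (s≤s z≤n) ≤-refl)) ≤-refl ,
            λ l 1≤l l<i → subst (λ y → t + 1 ∸ dist (O i) (O l) ≤ ∣ i - y ∣)
                                (sym (labl≡l 1≤l l<i)) (identityRadio-< idRadio 1≤l l<i i≤N)

    inducesConsecutiveRadio⇔ :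
      InducesConsecutiveRadio O ⇔ (NoRepeatedRows O × IdentityRadio O)
    inducesConsecutiveRadio⇔ = mk⇔
      (λ ((noRep , _) , consecutive) → let lab , induced = inducedLabeling in
         noRep , consecutive⇒identityRadio induced (consecutive lab induced))
      (λ (noRep , idRadio) → (noRep , rows-surjective noRep) ,
         λ lab induced → ≡id⇒consecutiveRadio idRadio (identityRadio⇒≡id induced idRadio))

  module _ {Δ : Generators} {O' : Matrix} (weakOrderGen : IsWeakOrderGen Δ O') where

    ΛCond⇔agree : ∀ j {i s} → s < i → i ≤ N →
                  ΛCond Δ O' j i s ⇔ (Φ O' i j ≡ Φ O' (i ∸ s) j)
    ΛCond⇔agree j {i} {s} s<i =
      subst (λ k → k ≤ N → ΛCond Δ O' j i s ⇔ (Φ O' k j ≡ Φ O' (i ∸ s) j))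
            (m∸n+n≡m (<⇒≤ s<i))
            (ColumnProperties.InΛ⇔φ-≡ (n j) (h j) (weakOrderGen j) (m<n⇒0<n∸m s<i))

    criterion⇒identityRadio : Criterion Δ O' → IdentityRadio (Φ O')
    criterion⇒identityRadio (noRep , bound) {i} {l} 1≤l l<i i≤N with i ∸ l <? t
    ... | yes s<t = ≤∸1⇒< (m<n⇒0<n∸m l<i) (≤-trans agreements≤∣A∣ ∣A∣≤s∸1)
      where
      witness = length-filter≤∣∣ (λ j → Φ O' i j Fin.≟ Φ O' l j) id
      A = proj₁ witness
      agreements≤∣A∣ = proj₂ (proj₂ witness)

      s<i : i ∸ l < i
      s<i = ∸-monoʳ-< {i} {l} {0} 1≤l (<⇒≤ l<i)

      A⊆Λ : ∀ j → j ∈ₛ A → ΛCond Δ O' j i (i ∸ l)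
      A⊆Λ j j∈A = Equivalence.from (ΛCond⇔agree j s<i i≤N)
        (subst (λ k → Φ O' i j ≡ Φ O' k j) (sym (m∸[m∸n]≡n (<⇒≤ l<i)))
               (proj₁ (proj₂ witness) j∈A))

      ∣A∣≤s∸1 : ∣ A ∣ ≤ i ∸ l ∸ 1
      ∣A∣≤s∸1 = bound i (≤-trans (s≤s 1≤l) l<i) i≤N (i ∸ l) (m<n⇒0<n∸m l<i) s<t s<i A A⊆Λ
    ... | no s≮t = ≤-trans (agreements<t (noRep i l 1≤i i≤N 1≤l l≤N (>⇒≢ l<i))) (≮⇒≥ s≮t)
      where
      1≤i = ≤-trans 1≤l (<⇒≤ l<i)
      l≤N = ≤-trans (<⇒≤ l<i) i≤N

    identityRadio⇒criterion : NoRepeatedRows (Φ O') × IdentityRadio (Φ O') → Criterion Δ O'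
    identityRadio⇒criterion (noRep , idRadio) = noRep , λ i _ i≤N s 1≤s _ s<i A A⊆Λ →
      let open ≤-Reasoning in <⇒≤∸1 (begin-strict
        ∣ A ∣                                ≤⟨ ∣∣≤agreements A (λ {j} →
                                                   Equivalence.to (ΛCond⇔agree j s<i i≤N) ∘ A⊆Λ j) ⟩
        agreements (Φ O' i) (Φ O' (i ∸ s))  <⟨ idRadio (m<n⇒0<n∸m s<i)
                                                   (∸-monoʳ-< {i} {s} {0} 1≤s (<⇒≤ s<i)) i≤N ⟩
        i ∸ (i ∸ s)                         ≡⟨ m∸[m∸n]≡n (<⇒≤ s<i) ⟩
        s                                   ∎)

    criterion⇔ : Criterion Δ O' ⇔ (NoRepeatedRows (Φ O') × IdentityRadio (Φ O'))
    criterion⇔ = mk⇔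
      (λ criterion → proj₁ criterion , λ {i} {l} → criterion⇒identityRadio criterion {i} {l})
      identityRadio⇒criterion

theorem30 : (t : ℕ) (n : Fin t → ℕ) (h : ∀ j → 3 ≤ n j) →
  let open Setup t n h in
  (Δ : Generators) (O' : Matrix) → IsWeakOrderGen Δ O' →
  InducesConsecutiveRadio (Φ O') ⇔ Criterion Δ O'
theorem30 t n h Δ O' weakOrderGen =
  ⇔-sym (criterion⇔ weakOrderGen) ⇔-∘ inducesConsecutiveRadio⇔ (Setup.Φ t n h O')
  where open Graph t n h
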